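{- Let $k$ be even and let $h:\{ -1,1\}^k\to\{ -1,1\}$ be any $\tfrac k2$-junta. Then $$\Pr_{\mathbf x\sim\{ -1,1\}^k}[\mathrm{MAJ}_k(\mathbf x)=h(\mathbf x)]\le\tfrac34+O(k^{ -1/2}),$$ where $\mathbf x$ is uniform.
   Context: $\mathrm{MAJ}_k(x)=\mathrm{sign}(\sum_{i=1}^k x_i)$, where $\mathrm{sign}(t)=1$ if $t\ge0$ and $-1$ otherwise. An $r$-junta is a function $h(x)=h'(x_S)$ for some $S\subseteq[k]$ with $|S|=r$ and $h':\{ -1,1\}^r\to\{ -1,1\}$. -}

module Defs where

open import Data.Bool using (Bool; true; false)
open import Data.Bool.Properties using () renaming (_≟_ to _≟ᴮ_)
open import Data.Nat using (ℕ; zero; suc)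
open import Data.Integer as ℤ using (ℤ; +_; _≤?_)
open import Data.Fin using (Fin)
open import Data.Vec using (Vec; []; _∷_; lookup; tabulate)
open import Data.List using (List; []; _∷_; map; _++_; filter; length)
open import Data.Product using (∃; ∃-syntax; Σ-syntax; _×_)
open import Function.Definitions using (Injective)
open import Relation.Binary.PropositionalEquality using (_≡_)
open import Relation.Nullary using (does)

-- A point of {-1,1}^k is a Vec Bool k; true ↦ +1, false ↦ -1.
toℤ : Bool → ℤ
toℤ true  = + 1
toℤ false = ℤ.- (+ 1)

sumℤ : ∀ {k} → Vec Bool k → ℤ
sumℤ []       = + 0
sumℤ (b ∷ xs) = toℤ b ℤ.+ sumℤ xs

sign : ℤ → Bool
sign t = does (+ 0 ≤? t)

MAJ : ∀ k → Vec Bool k → Bool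
MAJ k x = sign (sumℤ x)

-- h is an r-junta: there is an r-element set S ⊆ [k] (the image of an
-- injective map f : Fin r → Fin k) and h' : {-1,1}^r → {-1,1} with h(x) = h'(x_S).
IsJunta : ∀ {k} (r : ℕ) → (Vec Bool k → Bool) → Set
IsJunta {k} r h =
  Σ[ f ∈ (Fin r → Fin k) ] (Injective _≡_ _≡_ f ×
    (Σ[ h' ∈ (Vec Bool r → Bool) ]
      (∀ (x : Vec Bool k) → h x ≡ h' (tabulate (λ j → lookup x (f j))))))

cube : ∀ k → List (Vec Bool k)
cube zero    = [] ∷ []
cube (suc k) = map (true ∷_) (cube k) ++ map (false ∷_) (cube k)

-- number of x ∈ {-1,1}^k with MAJ_k(x) = h(x)  (= 2^k · Pr_x[MAJ_k(x) = h(x)])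
agree : ∀ k → (Vec Bool k → Bool) → ℕ
agree k h = length (filter (λ x → MAJ k x ≟ᴮ h x) (cube k))

-- Write x = (y, z) with y the r junta coordinates and z the other r, and let s and t be
-- the sums of y and z. Flipping z preserves h and sends MAJ x = sign (s + t) to
-- sign (s − t); when these two signs agree they equal sign s, so h agrees with MAJ on at
-- most as many x as satisfy sign (s + t) = sign s. Of the eight events
-- sign (±s ± t) = sign (±s) and sign (±t ± s) = sign (±t) at most six hold unless
-- |s| = |t|, and all these substitutions preserve the joint law of (s, t). Hence the
-- agreement probability is at most 3/4 + Pr[s + t = 0]/2, and
-- Pr[s + t = 0] = C(2r, r)/4^r ≤ (2r + 1)^(−1/2).
module Submission where

open import Defs
open import Algebra.Properties.CommutativeSemigroup using (interchange)
open import Data.Bool using (Bool; true; false; not; if_then_else_)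
open import Data.Bool.Properties using () renaming (_≟_ to _≟ᴮ_)
open import Data.Empty using (⊥-elim)
open import Data.Fin using (Fin; zero; suc)
import Data.Fin.Properties as Fin
open import Data.Fin.Subset using (Subset; inside; outside; ⊥; ⁅_⁆; _∪_; ∁; ∣_∣; _∈_; _∉_)
open import Data.Fin.Subset.Properties
  using (∉⊥; x∈⁅x⁆; x∈⁅y⁆⇒x≡y; x∈p∪q⁺; x∈p∪q⁻; ∪-identityˡ; ∣⊥∣≡0; ∣∁p∣≡n∸∣p∣)
open import Data.Integer as ℤ using (ℤ; -[1+_]; 0ℤ; 1ℤ; -1ℤ)
import Data.Integer.Properties as ℤ
import Data.Integer.Tactic.RingSolver as ℤ-Solver
open import Data.List using (List; []; _∷_; map; _++_; length; filter)
open import Data.List.Properties using (map-++; map-∘; length-++; length-map)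
open import Data.Nat using (ℕ; zero; suc; _+_; _*_; _∸_; _^_; _≤_; _<_; z≤n; s≤s; _!)
open import Data.Nat.Combinatorics using (_C_; nCk≡n!/k![n-k]!; k![n∸k]!∣n!; nCk+nC[k+1]≡[n+1]C[k+1])
open import Data.Nat.DivMod using (m/n*n≡m)
open import Data.Nat.ListAction using (sum)
open import Data.Nat.ListAction.Properties using (sum-++)
open import Data.Nat.Properties
import Data.Nat.Tactic.RingSolver as ℕ-Solver
open import Data.Product using (_,_; ∃-syntax)
open import Data.Sum using (_⊎_; inj₁; inj₂)
open import Data.Vec using (Vec; []; _∷_; lookup; tabulate; here; there)
import Data.Vec as Vec
open import Data.Vec.Properties using (tabulate-cong)
open import Function using (_∘_; _⇔_; mk⇔)
open import Function.Definitions using (Injective)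
open import Relation.Binary.Definitions using (tri<; tri≈; tri>)
open import Relation.Binary.PropositionalEquality
open import Relation.Nullary using (Dec; does)
open import Relation.Nullary.Decidable using (does-⇔; dec-true)
open import Relation.Unary using (Decidable)

private
  variable
    A B : Set

-- Sums over lists and over the cube

∑ : List A → (A → ℕ) → ℕ
∑ xs f = sum (map f xs)

syntax ∑ xs (λ x → e) = ∑[ x ∈ xs ] e

∑-cong : ∀ (xs : List A) {f g : A → ℕ} → (∀ x → f x ≡ g x) → ∑ xs f ≡ ∑ xs g
∑-cong []       f≗g = refl
∑-cong (x ∷ xs) f≗g = cong₂ _+_ (f≗g x) (∑-cong xs f≗g)

∑-mono-≤ : ∀ (xs : List A) {f g : A → ℕ} → (∀ x → f x ≤ g x) → ∑ xs f ≤ ∑ xs g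
∑-mono-≤ []       f≤g = z≤n
∑-mono-≤ (x ∷ xs) f≤g = +-mono-≤ (f≤g x) (∑-mono-≤ xs f≤g)

∑-distrib-+ : ∀ (xs : List A) (f g : A → ℕ) → ∑[ x ∈ xs ] (f x + g x) ≡ ∑ xs f + ∑ xs g
∑-distrib-+ []       f g = refl
∑-distrib-+ (x ∷ xs) f g = trans (cong (f x + g x +_) (∑-distrib-+ xs f g))
                                 (interchange +-commutativeSemigroup (f x) (g x) (∑ xs f) (∑ xs g))

∑-distribˡ-* : ∀ (xs : List A) c (f : A → ℕ) → ∑[ x ∈ xs ] (c * f x) ≡ c * ∑ xs f
∑-distribˡ-* []       c f = sym (*-zeroʳ c)
∑-distribˡ-* (x ∷ xs) c f = trans (cong (c * f x +_) (∑-distribˡ-* xs c f))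
                                  (sym (*-distribˡ-+ c (f x) (∑ xs f)))

∑-const : ∀ (xs : List A) c → ∑[ x ∈ xs ] c ≡ c * length xs
∑-const []       c = sym (*-zeroʳ c)
∑-const (x ∷ xs) c = trans (cong (c +_) (∑-const xs c)) (sym (*-suc c (length xs)))

∑-++ : ∀ (xs ys : List A) f → ∑ (xs ++ ys) f ≡ ∑ xs f + ∑ ys f
∑-++ xs ys f = trans (cong sum (map-++ f xs ys)) (sum-++ (map f xs) (map f ys))

∑-map : ∀ (g : B → A) (xs : List B) f → ∑ (map g xs) f ≡ ∑[ x ∈ xs ] f (g x)
∑-map g xs f = cong sum (sym (map-∘ xs))

∑-comm : ∀ (xs : List A) (ys : List B) (f : A → B → ℕ) →
         ∑[ x ∈ xs ] ∑[ y ∈ ys ] f x y ≡ ∑[ y ∈ ys ] ∑[ x ∈ xs ] f x y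
∑-comm []       ys f = sym (∑-const ys 0)
∑-comm (x ∷ xs) ys f = trans (cong (∑[ y ∈ ys ] f x y +_) (∑-comm xs ys f))
                             (sym (∑-distrib-+ ys (f x) (λ y → ∑[ x′ ∈ xs ] f x′ y)))

𝟙 : Dec A → ℕ
𝟙 a? = if does a? then 1 else 0

𝟙≤1 : (a? : Dec A) → 𝟙 a? ≤ 1
𝟙≤1 a? with does a?
... | true  = s≤s z≤n
... | false = z≤n

𝟙-true : (a? : Dec A) → A → 𝟙 a? ≡ 1
𝟙-true a? a = cong (if_then 1 else 0) (dec-true a? a)

𝟙-cong : A ⇔ B → (a? : Dec A) (b? : Dec B) → 𝟙 a? ≡ 𝟙 b?
𝟙-cong A⇔B a? b? = cong (if_then 1 else 0) (does-⇔ A⇔B a? b?)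

length-filter : ∀ {P : A → Set} (P? : Decidable P) (xs : List A) →
                length (filter P? xs) ≡ ∑[ x ∈ xs ] 𝟙 (P? x)
length-filter P? []       = refl
length-filter P? (x ∷ xs) with does (P? x)
... | true  = cong suc (length-filter P? xs)
... | false = length-filter P? xs

∑-cube-suc : ∀ n (f : Vec Bool (suc n) → ℕ) →
             ∑ (cube (suc n)) f ≡ ∑[ x ∈ cube n ] f (true ∷ x) + ∑[ x ∈ cube n ] f (false ∷ x)
∑-cube-suc n f = trans (∑-++ (map (true ∷_) (cube n)) _ f) (cong₂ _+_ (∑-map _ (cube n) f) (∑-map _ (cube n) f))

∑-cube-++ : ∀ a b (f : Vec Bool (a + b) → ℕ) →
            ∑ (cube (a + b)) f ≡ ∑[ y ∈ cube a ] ∑[ z ∈ cube b ] f (y Vec.++ z)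
∑-cube-++ zero    b f = sym (+-identityʳ _)
∑-cube-++ (suc a) b f = begin
  ∑ (cube (suc a + b)) f                                        ≡⟨ ∑-cube-suc (a + b) f ⟩
  ∑[ x ∈ cube (a + b) ] f (true ∷ x) + ∑[ x ∈ cube (a + b) ] f (false ∷ x)
    ≡⟨ cong₂ _+_ (∑-cube-++ a b (f ∘ (true ∷_))) (∑-cube-++ a b (f ∘ (false ∷_))) ⟩
  ∑[ y ∈ cube a ] ∑[ z ∈ cube b ] f (true ∷ y Vec.++ z) + ∑[ y ∈ cube a ] ∑[ z ∈ cube b ] f (false ∷ y Vec.++ z)
    ≡⟨ ∑-cube-suc a (λ y → ∑[ z ∈ cube b ] f (y Vec.++ z)) ⟨
  ∑[ y ∈ cube (suc a) ] ∑[ z ∈ cube b ] f (y Vec.++ z)          ∎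
  where open ≡-Reasoning

length-cube : ∀ n → length (cube n) ≡ 2 ^ n
length-cube zero    = refl
length-cube (suc n) = begin
  length (map (true ∷_) (cube n) ++ map (false ∷_) (cube n)) ≡⟨ length-++ (map (true ∷_) (cube n)) ⟩
  length (map (true ∷_) (cube n)) + length (map (false ∷_) (cube n))
    ≡⟨ cong₂ _+_ (length-map _ (cube n)) (length-map _ (cube n)) ⟩
  length (cube n) + length (cube n)                           ≡⟨ cong₂ _+_ (length-cube n) (length-cube n) ⟩
  2 ^ n + 2 ^ n                                               ≡⟨ cong (2 ^ n +_) (+-identityʳ (2 ^ n)) ⟨
  2 ^ suc n                                                   ∎
  where open ≡-Reasoning

-- Splitting the cube along a subset of coordinates

toℤ-not : ∀ b → toℤ (not b) ≡ ℤ.- toℤ b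
toℤ-not true  = refl
toℤ-not false = refl

sumℤ-++ : ∀ {a b} (y : Vec Bool a) (z : Vec Bool b) → sumℤ (y Vec.++ z) ≡ sumℤ y ℤ.+ sumℤ z
sumℤ-++ []      z = sym (ℤ.+-identityˡ (sumℤ z))
sumℤ-++ (b ∷ y) z = trans (cong (ℤ._+_ (toℤ b)) (sumℤ-++ y z)) (sym (ℤ.+-assoc (toℤ b) (sumℤ y) (sumℤ z)))

sumIn sumOut : ∀ {k} → Subset k → Vec Bool k → ℤ
sumIn  []            []      = 0ℤ
sumIn  (inside  ∷ m) (b ∷ x) = toℤ b ℤ.+ sumIn m x
sumIn  (outside ∷ m) (b ∷ x) = sumIn m x
sumOut []            []      = 0ℤ
sumOut (inside  ∷ m) (b ∷ x) = sumOut m x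
sumOut (outside ∷ m) (b ∷ x) = toℤ b ℤ.+ sumOut m x

flipOutside : ∀ {k} → Subset k → Vec Bool k → Vec Bool k
flipOutside []            []      = []
flipOutside (inside  ∷ m) (b ∷ x) = b ∷ flipOutside m x
flipOutside (outside ∷ m) (b ∷ x) = not b ∷ flipOutside m x

sumℤ≡sumIn+sumOut : ∀ {k} (m : Subset k) (x : Vec Bool k) → sumℤ x ≡ sumIn m x ℤ.+ sumOut m x
sumℤ≡sumIn+sumOut []            []      = refl
sumℤ≡sumIn+sumOut (inside  ∷ m) (b ∷ x) =
  trans (cong (ℤ._+_ (toℤ b)) (sumℤ≡sumIn+sumOut m x)) (sym (ℤ.+-assoc (toℤ b) (sumIn m x) (sumOut m x)))
sumℤ≡sumIn+sumOut (outside ∷ m) (b ∷ x) =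
  trans (cong (ℤ._+_ (toℤ b)) (sumℤ≡sumIn+sumOut m x)) (x+[y+z]≡y+[x+z] (toℤ b) (sumIn m x) (sumOut m x))
  where
  x+[y+z]≡y+[x+z] : ∀ a b c → a ℤ.+ (b ℤ.+ c) ≡ b ℤ.+ (a ℤ.+ c)
  x+[y+z]≡y+[x+z] = ℤ-Solver.solve-∀

sumIn-flipOutside : ∀ {k} (m : Subset k) (x : Vec Bool k) → sumIn m (flipOutside m x) ≡ sumIn m x
sumIn-flipOutside []            []      = refl
sumIn-flipOutside (inside  ∷ m) (b ∷ x) = cong (ℤ._+_ (toℤ b)) (sumIn-flipOutside m x)
sumIn-flipOutside (outside ∷ m) (b ∷ x) = sumIn-flipOutside m x

sumOut-flipOutside : ∀ {k} (m : Subset k) (x : Vec Bool k) → sumOut m (flipOutside m x) ≡ ℤ.- sumOut m x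
sumOut-flipOutside []            []      = refl
sumOut-flipOutside (inside  ∷ m) (b ∷ x) = sumOut-flipOutside m x
sumOut-flipOutside (outside ∷ m) (b ∷ x) =
  trans (cong₂ ℤ._+_ (toℤ-not b) (sumOut-flipOutside m x)) (sym (ℤ.neg-distrib-+ (toℤ b) (sumOut m x)))

sumℤ-flipOutside : ∀ {k} (m : Subset k) (x : Vec Bool k) → sumℤ (flipOutside m x) ≡ sumIn m x ℤ.- sumOut m x
sumℤ-flipOutside m x = trans (sumℤ≡sumIn+sumOut m (flipOutside m x))
                             (cong₂ ℤ._+_ (sumIn-flipOutside m x) (sumOut-flipOutside m x))

sumℤ-flipOutside-⊥ : ∀ {k} (x : Vec Bool k) → sumℤ (flipOutside ⊥ x) ≡ ℤ.- sumℤ x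
sumℤ-flipOutside-⊥ []      = refl
sumℤ-flipOutside-⊥ (b ∷ x) =
  trans (cong₂ ℤ._+_ (toℤ-not b) (sumℤ-flipOutside-⊥ x)) (sym (ℤ.neg-distrib-+ (toℤ b) (sumℤ x)))

∑-cube-flipOutside : ∀ {k} (m : Subset k) (f : Vec Bool k → ℕ) →
                     ∑[ x ∈ cube k ] f (flipOutside m x) ≡ ∑ (cube k) f
∑-cube-flipOutside []            f = refl
∑-cube-flipOutside {suc k} (inside ∷ m) f = begin
  ∑[ x ∈ cube (suc k) ] f (flipOutside (inside ∷ m) x)                       ≡⟨ ∑-cube-suc k _ ⟩
  ∑[ x ∈ cube k ] f (true ∷ flipOutside m x) + ∑[ x ∈ cube k ] f (false ∷ flipOutside m x)
    ≡⟨ cong₂ _+_ (∑-cube-flipOutside m (f ∘ (true ∷_))) (∑-cube-flipOutside m (f ∘ (false ∷_))) ⟩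
  ∑[ x ∈ cube k ] f (true ∷ x) + ∑[ x ∈ cube k ] f (false ∷ x)                ≡⟨ ∑-cube-suc k f ⟨
  ∑ (cube (suc k)) f                                                         ∎
  where open ≡-Reasoning
∑-cube-flipOutside {suc k} (outside ∷ m) f = begin
  ∑[ x ∈ cube (suc k) ] f (flipOutside (outside ∷ m) x)                      ≡⟨ ∑-cube-suc k _ ⟩
  ∑[ x ∈ cube k ] f (false ∷ flipOutside m x) + ∑[ x ∈ cube k ] f (true ∷ flipOutside m x)
    ≡⟨ cong₂ _+_ (∑-cube-flipOutside m (f ∘ (false ∷_))) (∑-cube-flipOutside m (f ∘ (true ∷_))) ⟩
  ∑[ x ∈ cube k ] f (false ∷ x) + ∑[ x ∈ cube k ] f (true ∷ x)
    ≡⟨ +-comm (∑[ x ∈ cube k ] f (false ∷ x)) _ ⟩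
  ∑[ x ∈ cube k ] f (true ∷ x) + ∑[ x ∈ cube k ] f (false ∷ x)                ≡⟨ ∑-cube-suc k f ⟨
  ∑ (cube (suc k)) f                                                         ∎
  where open ≡-Reasoning

∑-cube-neg : ∀ n (p : ℤ → ℕ) → ∑[ x ∈ cube n ] p (sumℤ x) ≡ ∑[ x ∈ cube n ] p (ℤ.- sumℤ x)
∑-cube-neg n p = trans (sym (∑-cube-flipOutside {n} ⊥ (p ∘ sumℤ)))
                       (∑-cong (cube n) (λ x → cong p (sumℤ-flipOutside-⊥ x)))

Σ² : ℕ → ℕ → (ℤ → ℤ → ℕ) → ℕ
Σ² a b P = ∑[ y ∈ cube a ] ∑[ z ∈ cube b ] P (sumℤ y) (sumℤ z)

∑-cube-split : ∀ {k} (m : Subset k) (P : ℤ → ℤ → ℕ) →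
               ∑[ x ∈ cube k ] P (sumIn m x) (sumOut m x) ≡ Σ² (∣ m ∣) (∣ ∁ m ∣) P
∑-cube-split []            P = sym (+-identityʳ _)
∑-cube-split {suc k} (inside ∷ m) P = begin
  ∑[ x ∈ cube (suc k) ] P (sumIn (inside ∷ m) x) (sumOut (inside ∷ m) x)        ≡⟨ ∑-cube-suc k _ ⟩
  ∑[ x ∈ cube k ] P (1ℤ ℤ.+ sumIn m x) (sumOut m x) + ∑[ x ∈ cube k ] P (-1ℤ ℤ.+ sumIn m x) (sumOut m x)
    ≡⟨ cong₂ _+_ (∑-cube-split m (P ∘ ℤ._+_ 1ℤ)) (∑-cube-split m (P ∘ ℤ._+_ -1ℤ)) ⟩
  Σ² a b (P ∘ ℤ._+_ 1ℤ) + Σ² a b (P ∘ ℤ._+_ -1ℤ)                                ≡⟨ ∑-cube-suc a _ ⟨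
  Σ² (suc a) b P                                                                ∎
  where
  open ≡-Reasoning
  a = ∣ m ∣
  b = ∣ ∁ m ∣
∑-cube-split {suc k} (outside ∷ m) P = begin
  ∑[ x ∈ cube (suc k) ] P (sumIn (outside ∷ m) x) (sumOut (outside ∷ m) x)      ≡⟨ ∑-cube-suc k _ ⟩
  ∑[ x ∈ cube k ] P (sumIn m x) (1ℤ ℤ.+ sumOut m x) + ∑[ x ∈ cube k ] P (sumIn m x) (-1ℤ ℤ.+ sumOut m x)
    ≡⟨ cong₂ _+_ (∑-cube-split m (λ s t → P s (1ℤ ℤ.+ t))) (∑-cube-split m (λ s t → P s (-1ℤ ℤ.+ t))) ⟩
  Σ² a b (λ s t → P s (1ℤ ℤ.+ t)) + Σ² a b (λ s t → P s (-1ℤ ℤ.+ t))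
    ≡⟨ ∑-distrib-+ (cube a) _ _ ⟨
  ∑[ y ∈ cube a ] (∑[ z ∈ cube b ] P (sumℤ y) (1ℤ ℤ.+ sumℤ z) + ∑[ z ∈ cube b ] P (sumℤ y) (-1ℤ ℤ.+ sumℤ z))
    ≡⟨ ∑-cong (cube a) (λ y → ∑-cube-suc b _) ⟨
  Σ² a (suc b) P                                                                ∎
  where
  open ≡-Reasoning
  a = ∣ m ∣
  b = ∣ ∁ m ∣

Σ²-mono-≤ : ∀ a b {P R : ℤ → ℤ → ℕ} → (∀ s t → P s t ≤ R s t) → Σ² a b P ≤ Σ² a b R
Σ²-mono-≤ a b P≤R = ∑-mono-≤ (cube a) (λ y → ∑-mono-≤ (cube b) (λ z → P≤R _ _))

Σ²-distrib-+ : ∀ a b (P R : ℤ → ℤ → ℕ) → Σ² a b (λ s t → P s t + R s t) ≡ Σ² a b P + Σ² a b R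
Σ²-distrib-+ a b P R = trans (∑-cong (cube a) (λ y → ∑-distrib-+ (cube b) _ _)) (∑-distrib-+ (cube a) _ _)

Σ²-distribˡ-* : ∀ a b c (P : ℤ → ℤ → ℕ) → Σ² a b (λ s t → c * P s t) ≡ c * Σ² a b P
Σ²-distribˡ-* a b c P = trans (∑-cong (cube a) (λ y → ∑-distribˡ-* (cube b) c _)) (∑-distribˡ-* (cube a) c _)

Σ²-comm : ∀ a b (P : ℤ → ℤ → ℕ) → Σ² a b P ≡ Σ² b a (λ t s → P s t)
Σ²-comm a b P = ∑-comm (cube a) (cube b) _

Σ²-negˡ : ∀ a b (P : ℤ → ℤ → ℕ) → Σ² a b P ≡ Σ² a b (λ s t → P (ℤ.- s) t)
Σ²-negˡ a b P = ∑-cube-neg a (λ s → ∑[ z ∈ cube b ] P s (sumℤ z))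

Σ²-negʳ : ∀ a b (P : ℤ → ℤ → ℕ) → Σ² a b P ≡ Σ² a b (λ s t → P s (ℤ.- t))
Σ²-negʳ a b P = ∑-cong (cube a) (λ y → ∑-cube-neg b (P (sumℤ y)))

Σ²-+ : ∀ a b (p : ℤ → ℕ) → Σ² a b (λ s t → p (s ℤ.+ t)) ≡ ∑[ x ∈ cube (a + b) ] p (sumℤ x)
Σ²-+ a b p = sym (trans (∑-cube-++ a b (p ∘ sumℤ))
                        (∑-cong (cube a) (λ y → ∑-cong (cube b) (λ z → cong p (sumℤ-++ y z)))))

Σ²-const : ∀ a b c → Σ² a b (λ _ _ → c) ≡ c * 2 ^ (a + b)
Σ²-const a b c = trans (Σ²-+ a b (λ _ → c))
                       (trans (∑-const (cube (a + b)) c) (cong (c *_) (length-cube (a + b))))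

-- Sign agreement of two independent walks

δ : Bool → Bool → ℕ
δ a b = 𝟙 (a ≟ᴮ b)

δ-not : ∀ c d → δ c d + δ c (not d) ≡ 1
δ-not true  true  = refl
δ-not true  false = refl
δ-not false true  = refl
δ-not false false = refl

δ-pair : ∀ a b c h → (a ≡ b → c ≡ a) → δ a h + δ b h ≤ δ c a + δ c b
δ-pair true  true  c h a≡b⇒c≡a with a≡b⇒c≡a refl
... | refl = +-mono-≤ (𝟙≤1 (true ≟ᴮ h)) (𝟙≤1 (true ≟ᴮ h))
δ-pair false false c h a≡b⇒c≡a with a≡b⇒c≡a refl
... | refl = +-mono-≤ (𝟙≤1 (false ≟ᴮ h)) (𝟙≤1 (false ≟ᴮ h))
δ-pair true  false c true  _ = ≤-reflexive (sym (δ-not c true))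
δ-pair true  false c false _ = ≤-reflexive (sym (δ-not c true))
δ-pair false true  c true  _ = ≤-reflexive (sym (δ-not c false))
δ-pair false true  c false _ = ≤-reflexive (sym (δ-not c false))

sign-mean : ∀ s u v → u ℤ.+ v ≡ s ℤ.+ s → sign u ≡ sign v → sign s ≡ sign u
sign-mean (ℤ.+ _)  (ℤ.+ _)  (ℤ.+ _)  _  _  = refl
sign-mean -[1+ _ ] -[1+ _ ] -[1+ _ ] _  _  = refl
sign-mean -[1+ _ ] (ℤ.+ _)  (ℤ.+ _)  () _
sign-mean (ℤ.+ _)  -[1+ _ ] -[1+ _ ] () _
sign-mean _        (ℤ.+ _)  -[1+ _ ] _  ()
sign-mean _        -[1+ _ ] (ℤ.+ _)  _  ()

sign-+-dominated : ∀ s t → ℤ.∣ s ∣ < ℤ.∣ t ∣ → sign (s ℤ.+ t) ≡ sign t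
sign-+-dominated (ℤ.+ _)  (ℤ.+ _)  _ = refl
sign-+-dominated -[1+ _ ] (ℤ.+ _)  s<t rewrite ℤ.⊖-≥ (<⇒≤ s<t) = refl
sign-+-dominated (ℤ.+ _)  -[1+ _ ] (s≤s s≤t) rewrite ℤ.⊖-< (s≤s s≤t) | +-∸-assoc 1 s≤t = refl
sign-+-dominated -[1+ _ ] -[1+ _ ] _ = refl

sign-neg : ∀ t → 0 < ℤ.∣ t ∣ → sign (ℤ.- t) ≡ not (sign t)
sign-neg (ℤ.+ suc _) _ = refl
sign-neg -[1+ _ ]    _ = refl

∣i∣≡∣j∣⇒i≡j⊎i≡-j : ∀ i j → ℤ.∣ i ∣ ≡ ℤ.∣ j ∣ → i ≡ j ⊎ i ≡ ℤ.- j
∣i∣≡∣j∣⇒i≡j⊎i≡-j (ℤ.+ _)        (ℤ.+ _)  e    = inj₁ (cong ℤ.+_ e)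
∣i∣≡∣j∣⇒i≡j⊎i≡-j -[1+ _ ]       -[1+ _ ] e    = inj₁ (cong -[1+_] (suc-injective e))
∣i∣≡∣j∣⇒i≡j⊎i≡-j (ℤ.+ .(suc n)) -[1+ n ] refl = inj₂ refl
∣i∣≡∣j∣⇒i≡j⊎i≡-j -[1+ n ]       (ℤ.+ .(suc n)) refl = inj₂ refl

keepsSign keepsSign± keepsSign±± : ℤ → ℤ → ℕ
keepsSign   s t = δ (sign s) (sign (s ℤ.+ t))
keepsSign±  s t = keepsSign s t + keepsSign s (ℤ.- t)
keepsSign±± s t = keepsSign± s t + keepsSign± (ℤ.- s) t

cancels± : ℤ → ℤ → ℕ
cancels± s t = 𝟙 (s ℤ.+ t ℤ.≟ 0ℤ) + 𝟙 (s ℤ.- t ℤ.≟ 0ℤ)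

keepsSign±-dominated : ∀ s t → ℤ.∣ s ∣ < ℤ.∣ t ∣ → keepsSign± s t ≡ 1
keepsSign±-dominated s t ∣s∣<∣t∣ = begin
  δ (sign s) (sign (s ℤ.+ t)) + δ (sign s) (sign (s ℤ.- t))
    ≡⟨ cong₂ (λ u v → δ (sign s) u + δ (sign s) v) (sign-+-dominated s t ∣s∣<∣t∣) sign[s-t]≡¬sign[t] ⟩
  δ (sign s) (sign t) + δ (sign s) (not (sign t))          ≡⟨ δ-not (sign s) (sign t) ⟩
  1                                                        ∎
  where
  open ≡-Reasoning
  sign[s-t]≡¬sign[t] : sign (s ℤ.- t) ≡ not (sign t)
  sign[s-t]≡¬sign[t] = trans (sign-+-dominated s (ℤ.- t) (subst (ℤ.∣ s ∣ <_) (sym (ℤ.∣-i∣≡∣i∣ t)) ∣s∣<∣t∣))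
                             (sign-neg t (≤-<-trans z≤n ∣s∣<∣t∣))

keepsSign±±-dominated : ∀ s t → ℤ.∣ s ∣ < ℤ.∣ t ∣ → keepsSign±± s t ≡ 2
keepsSign±±-dominated s t ∣s∣<∣t∣ =
  cong₂ _+_ (keepsSign±-dominated s t ∣s∣<∣t∣)
            (keepsSign±-dominated (ℤ.- s) t (subst (_< ℤ.∣ t ∣) (sym (ℤ.∣-i∣≡∣i∣ s)) ∣s∣<∣t∣))

keepsSign±±≤4 : ∀ s t → keepsSign±± s t ≤ 4
keepsSign±±≤4 s t =
  +-mono-≤ (+-mono-≤ (δ≤1 s t) (δ≤1 s (ℤ.- t))) (+-mono-≤ (δ≤1 (ℤ.- s) t) (δ≤1 (ℤ.- s) (ℤ.- t)))
  where
  δ≤1 : ∀ s t → keepsSign s t ≤ 1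
  δ≤1 s t = 𝟙≤1 (sign s ≟ᴮ sign (s ℤ.+ t))

cancels±-≥1 : ∀ s t → ℤ.∣ s ∣ ≡ ℤ.∣ t ∣ → 1 ≤ cancels± s t
cancels±-≥1 s t ∣s∣≡∣t∣ with ∣i∣≡∣j∣⇒i≡j⊎i≡-j s t ∣s∣≡∣t∣
... | inj₁ refl = ≤-trans (≤-reflexive (sym (𝟙-true (s ℤ.- s ℤ.≟ 0ℤ) (ℤ.+-inverseʳ s)))) (m≤n+m _ _)
... | inj₂ refl = ≤-trans (≤-reflexive (sym (𝟙-true (ℤ.- t ℤ.+ t ℤ.≟ 0ℤ) (ℤ.+-inverseˡ t)))) (m≤m+n _ _)

keepsSign±±-swap-bound : ∀ s t → keepsSign±± s t + keepsSign±± t s ≤ 6 + 2 * cancels± s t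
keepsSign±±-swap-bound s t with <-cmp ℤ.∣ s ∣ ℤ.∣ t ∣
... | tri< ∣s∣<∣t∣ _ _ =
  ≤-trans (+-mono-≤ (≤-reflexive (keepsSign±±-dominated s t ∣s∣<∣t∣)) (keepsSign±±≤4 t s)) (m≤m+n 6 _)
... | tri> _ _ ∣t∣<∣s∣ =
  ≤-trans (+-mono-≤ (keepsSign±±≤4 s t) (≤-reflexive (keepsSign±±-dominated t s ∣t∣<∣s∣))) (m≤m+n 6 _)
... | tri≈ _ ∣s∣≡∣t∣ _ =
  ≤-trans (+-mono-≤ (keepsSign±±≤4 s t) (keepsSign±±≤4 t s)) (+-monoʳ-≤ 6 (*-monoʳ-≤ 2 (cancels±-≥1 s t ∣s∣≡∣t∣)))

balanced : ℕ → ℕ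
balanced n = ∑[ x ∈ cube n ] 𝟙 (sumℤ x ℤ.≟ 0ℤ)

Σ²-keepsSign± : ∀ a b → Σ² a b keepsSign± ≡ 2 * Σ² a b keepsSign
Σ²-keepsSign± a b = begin
  Σ² a b keepsSign±                             ≡⟨ Σ²-distrib-+ a b keepsSign (λ s t → keepsSign s (ℤ.- t)) ⟩
  K + Σ² a b (λ s t → keepsSign s (ℤ.- t))       ≡⟨ cong (K +_) (Σ²-negʳ a b keepsSign) ⟨
  K + K                                         ≡⟨ cong (K +_) (+-identityʳ K) ⟨
  2 * K                                         ∎
  where
  open ≡-Reasoning
  K = Σ² a b keepsSign

Σ²-keepsSign±± : ∀ a b → Σ² a b keepsSign±± ≡ 4 * Σ² a b keepsSign
Σ²-keepsSign±± a b = begin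
  Σ² a b keepsSign±±
    ≡⟨ Σ²-distrib-+ a b keepsSign± (λ s t → keepsSign± (ℤ.- s) t) ⟩
  K± + Σ² a b (λ s t → keepsSign± (ℤ.- s) t)   ≡⟨ cong (K± +_) (Σ²-negˡ a b keepsSign±) ⟨
  K± + K±                                      ≡⟨ cong₂ _+_ (Σ²-keepsSign± a b) (Σ²-keepsSign± a b) ⟩
  2 * K + 2 * K                                ≡⟨ *-distribʳ-+ K 2 2 ⟨
  4 * K                                        ∎
  where
  open ≡-Reasoning
  K = Σ² a b keepsSign
  K± = Σ² a b keepsSign±

Σ²-cancels± : ∀ a b → Σ² a b cancels± ≡ 2 * balanced (a + b)
Σ²-cancels± a b = begin
  Σ² a b cancels±                                   ≡⟨ Σ²-distrib-+ a b P (λ s t → P s (ℤ.- t)) ⟩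
  Σ² a b P + Σ² a b (λ s t → P s (ℤ.- t))           ≡⟨ cong (Σ² a b P +_) (Σ²-negʳ a b P) ⟨
  Σ² a b P + Σ² a b P                               ≡⟨ cong (Σ² a b P +_) (+-identityʳ (Σ² a b P)) ⟨
  2 * Σ² a b P                                      ≡⟨ cong (2 *_) (Σ²-+ a b (λ u → 𝟙 (u ℤ.≟ 0ℤ))) ⟩
  2 * balanced (a + b)                              ∎
  where
  open ≡-Reasoning
  P : ℤ → ℤ → ℕ
  P s t = 𝟙 (s ℤ.+ t ℤ.≟ 0ℤ)

keepsSign-count : ∀ r → 4 * Σ² r r keepsSign ≤ 3 * 2 ^ (r + r) + 2 * balanced (r + r)
keepsSign-count r = *-cancelˡ-≤ 2 (begin
  2 * (4 * Σ² r r keepsSign)                            ≡⟨ cong (2 *_) (Σ²-keepsSign±± r r) ⟨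
  2 * Q
    ≡⟨ cong (Q +_) (trans (+-identityʳ Q) (Σ²-comm r r keepsSign±±)) ⟩
  Q + Σ² r r (λ s t → keepsSign±± t s)
    ≡⟨ Σ²-distrib-+ r r keepsSign±± (λ s t → keepsSign±± t s) ⟨
  Σ² r r (λ s t → keepsSign±± s t + keepsSign±± t s)    ≤⟨ Σ²-mono-≤ r r keepsSign±±-swap-bound ⟩
  Σ² r r (λ s t → 6 + 2 * cancels± s t)
    ≡⟨ Σ²-distrib-+ r r (λ _ _ → 6) (λ s t → 2 * cancels± s t) ⟩
  Σ² r r (λ _ _ → 6) + Σ² r r (λ s t → 2 * cancels± s t)
    ≡⟨ cong₂ _+_ (Σ²-const r r 6) (trans (Σ²-distribˡ-* r r 2 cancels±) (cong (2 *_) (Σ²-cancels± r r))) ⟩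
  6 * 2 ^ (r + r) + 2 * (2 * balanced (r + r))          ≡⟨ regroup (2 ^ (r + r)) (balanced (r + r)) ⟩
  2 * (3 * 2 ^ (r + r) + 2 * balanced (r + r))          ∎)
  where
  open ≤-Reasoning
  Q = Σ² r r keepsSign±±
  regroup : ∀ N Z → 6 * N + 2 * (2 * Z) ≡ 2 * (3 * N + 2 * Z)
  regroup = ℕ-Solver.solve-∀

-- Central binomial coefficients

∑-cube-∣x∣≡j : ∀ n j → ∑[ x ∈ cube n ] 𝟙 (∣ x ∣ ≟ j) ≡ n C j
∑-cube-∣x∣≡j zero    zero    = refl
∑-cube-∣x∣≡j zero    (suc j) = refl
∑-cube-∣x∣≡j (suc n) zero    = trans (∑-cube-suc n _) (cong₂ _+_ (∑-const (cube n) 0) (∑-cube-∣x∣≡j n zero))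
∑-cube-∣x∣≡j (suc n) (suc j) = trans (∑-cube-suc n _)
  (trans (cong₂ _+_ (∑-cube-∣x∣≡j n j) (∑-cube-∣x∣≡j n (suc j))) (nCk+nC[k+1]≡[n+1]C[k+1] n j))

sumℤ≡2∣x∣-n : ∀ {n} (x : Vec Bool n) → sumℤ x ≡ (ℤ.+ ∣ x ∣ ℤ.+ ℤ.+ ∣ x ∣) ℤ.- ℤ.+ n
sumℤ≡2∣x∣-n []          = refl
sumℤ≡2∣x∣-n {suc n} (true  ∷ x) = trans (cong (ℤ._+_ 1ℤ) (sumℤ≡2∣x∣-n x)) (step (ℤ.+ ∣ x ∣) (ℤ.+ n))
  where
  step : ∀ c n → 1ℤ ℤ.+ ((c ℤ.+ c) ℤ.- n) ≡ ((1ℤ ℤ.+ c) ℤ.+ (1ℤ ℤ.+ c)) ℤ.- (1ℤ ℤ.+ n)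
  step = ℤ-Solver.solve-∀
sumℤ≡2∣x∣-n {suc n} (false ∷ x) = trans (cong (ℤ._+_ -1ℤ) (sumℤ≡2∣x∣-n x)) (step (ℤ.+ ∣ x ∣) (ℤ.+ n))
  where
  step : ∀ c n → -1ℤ ℤ.+ ((c ℤ.+ c) ℤ.- n) ≡ (c ℤ.+ c) ℤ.- (1ℤ ℤ.+ n)
  step = ℤ-Solver.solve-∀

sumℤ≡0⇔∣x∣≡r : ∀ {r} (x : Vec Bool (r + r)) → sumℤ x ≡ 0ℤ ⇔ ∣ x ∣ ≡ r
sumℤ≡0⇔∣x∣≡r {r} x = mk⇔ to from
  where
  to : sumℤ x ≡ 0ℤ → ∣ x ∣ ≡ r
  to sum≡0 = *-cancelˡ-≡ ∣ x ∣ r 2 (begin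
    ∣ x ∣ + (∣ x ∣ + 0) ≡⟨ cong (∣ x ∣ +_) (+-identityʳ ∣ x ∣) ⟩
    ∣ x ∣ + ∣ x ∣       ≡⟨ ℤ.+-injective (trans (ℤ.pos-+ ∣ x ∣ ∣ x ∣)
                             (ℤ.i-j≡0⇒i≡j _ _ (trans (sym (sumℤ≡2∣x∣-n x)) sum≡0))) ⟩
    r + r               ≡⟨ cong (r +_) (+-identityʳ r) ⟨
    r + (r + 0)         ∎)
    where open ≡-Reasoning
  from : ∣ x ∣ ≡ r → sumℤ x ≡ 0ℤ
  from ∣x∣≡r = begin
    sumℤ x                                     ≡⟨ sumℤ≡2∣x∣-n x ⟩
    (ℤ.+ ∣ x ∣ ℤ.+ ℤ.+ ∣ x ∣) ℤ.- ℤ.+ (r + r)  ≡⟨ cong (λ c → (ℤ.+ c ℤ.+ ℤ.+ c) ℤ.- ℤ.+ (r + r)) ∣x∣≡r ⟩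
    (ℤ.+ r ℤ.+ ℤ.+ r) ℤ.- ℤ.+ (r + r)          ≡⟨ cong (ℤ._- ℤ.+ (r + r)) (ℤ.pos-+ r r) ⟨
    ℤ.+ (r + r) ℤ.- ℤ.+ (r + r)                ≡⟨ ℤ.+-inverseʳ (ℤ.+ (r + r)) ⟩
    0ℤ                                         ∎
    where open ≡-Reasoning

central : ℕ → ℕ
central r = (r + r) C r

balanced≡central : ∀ r → balanced (r + r) ≡ central r
balanced≡central r = trans (∑-cong (cube (r + r)) (λ x → 𝟙-cong (sumℤ≡0⇔∣x∣≡r x) (sumℤ x ℤ.≟ 0ℤ) (∣ x ∣ ≟ r)))
                            (∑-cube-∣x∣≡j (r + r) r)

nCk*[k!*[n∸k]!]≡n! : ∀ {n k} → k ≤ n → (n C k) * (k ! * (n ∸ k) !) ≡ n !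
nCk*[k!*[n∸k]!]≡n! {n} {k} k≤n =
  trans (cong (_* (k ! * (n ∸ k) !)) (nCk≡n!/k![n-k]! k≤n)) (m/n*n≡m (k![n∸k]!∣n! k≤n))
  where instance _ = k !* (n ∸ k) !≢0

central*r!*r!≡[r+r]! : ∀ r → central r * (r ! * r !) ≡ (r + r) !
central*r!*r!≡[r+r]! r =
  subst (λ u → central r * (r ! * u !) ≡ (r + r) !) (m+n∸m≡n r r) (nCk*[k!*[n∸k]!]≡n! (m≤m+n r r))

central-suc : ∀ r → suc r * central (suc r) ≡ 2 * (suc (r + r) * central r)
central-suc r = *-cancelʳ-≡ _ _ (suc r * (r ! * r !)) (begin
  suc r * central (suc r) * (suc r * (r ! * r !))      ≡⟨ regroupˡ r (central (suc r)) (r !) ⟩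
  central (suc r) * (suc r ! * suc r !)                ≡⟨ central*r!*r!≡[r+r]! (suc r) ⟩
  (suc r + suc r) !                                    ≡⟨ cong (λ n → suc n !) (+-suc r r) ⟩
  (2 + (r + r)) * ((1 + (r + r)) * (r + r) !)
    ≡⟨ cong (λ u → (2 + (r + r)) * ((1 + (r + r)) * u)) (central*r!*r!≡[r+r]! r) ⟨
  (2 + (r + r)) * ((1 + (r + r)) * (central r * (r ! * r !))) ≡⟨ regroupʳ r (central r) (r !) ⟩
  2 * (suc (r + r) * central r) * (suc r * (r ! * r !)) ∎)
  where
  open ≡-Reasoning
  instance
    _ = r !* r !≢0
    _ = m*n≢0 (suc r) (r ! * r !)
  regroupˡ : ∀ r c f → (1 + r) * c * ((1 + r) * (f * f)) ≡ c * (((1 + r) * f) * ((1 + r) * f))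
  regroupˡ = ℕ-Solver.solve-∀
  regroupʳ : ∀ r c f → (2 + (r + r)) * ((1 + (r + r)) * (c * (f * f)))
                       ≡ 2 * ((1 + (r + r)) * c) * ((1 + r) * (f * f))
  regroupʳ = ℕ-Solver.solve-∀

central-bound : ∀ r → central r * central r * suc (r + r) ≤ 16 ^ r
central-bound zero    = ≤-refl
central-bound (suc r) = *-cancelˡ-≤ (suc r * suc r) (begin
  suc r * suc r * (central (suc r) * central (suc r) * suc (suc r + suc r))
    ≡⟨ regroup₁ r (central (suc r)) ⟩
  (suc r * central (suc r)) * (suc r * central (suc r)) * (3 + (r + r))
    ≡⟨ cong (λ u → u * u * (3 + (r + r))) (central-suc r) ⟩
  (2 * (suc (r + r) * c)) * (2 * (suc (r + r) * c)) * (3 + (r + r))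
    ≡⟨ regroup₂ r c ⟩
  4 * (c * c * suc (r + r)) * (suc (r + r) * (3 + (r + r)))
    ≤⟨ *-mono-≤ (*-monoʳ-≤ 4 (central-bound r)) (≤-trans (m≤m+n _ 1) (≤-reflexive (sym (regroup₃ r)))) ⟩
  4 * 16 ^ r * (4 * (suc r * suc r))
    ≡⟨ regroup₄ r (16 ^ r) ⟩
  suc r * suc r * (16 * 16 ^ r) ∎)
  where
  open ≤-Reasoning
  c = central r
  regroup₁ : ∀ r c → (1 + r) * (1 + r) * (c * c * (2 + (r + (1 + r))))
                     ≡ ((1 + r) * c) * ((1 + r) * c) * (3 + (r + r))
  regroup₁ = ℕ-Solver.solve-∀
  regroup₂ : ∀ r c → (2 * ((1 + (r + r)) * c)) * (2 * ((1 + (r + r)) * c)) * (3 + (r + r))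
                     ≡ 4 * (c * c * (1 + (r + r))) * ((1 + (r + r)) * (3 + (r + r)))
  regroup₂ = ℕ-Solver.solve-∀
  regroup₃ : ∀ r → 4 * ((1 + r) * (1 + r)) ≡ (1 + (r + r)) * (3 + (r + r)) + 1
  regroup₃ = ℕ-Solver.solve-∀
  regroup₄ : ∀ r P → 4 * P * (4 * ((1 + r) * (1 + r))) ≡ (1 + r) * (1 + r) * (16 * P)
  regroup₄ = ℕ-Solver.solve-∀

-- Juntas

agree≡∑δ : ∀ k (h : Vec Bool k → Bool) → agree k h ≡ ∑[ x ∈ cube k ] δ (MAJ k x) (h x)
agree≡∑δ k h = length-filter (λ x → MAJ k x ≟ᴮ h x) (cube k)

agree≤Σ²keepsSign : ∀ {k} (m : Subset k) (h : Vec Bool k → Bool) → (∀ x → h (flipOutside m x) ≡ h x) →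
                    agree k h ≤ Σ² (∣ m ∣) (∣ ∁ m ∣) keepsSign
agree≤Σ²keepsSign {k} m h h∘flip≗h = *-cancelˡ-≤ 2 (begin
  2 * agree k h                                        ≡⟨ cong (2 *_) (agree≡∑δ k h) ⟩
  2 * a                                                ≡⟨ cong (a +_) (+-identityʳ a) ⟩
  a + a                                                ≡⟨ cong (a +_) (∑-cube-flipOutside m w) ⟨
  a + ∑[ x ∈ cube k ] w (flipOutside m x)              ≡⟨ ∑-distrib-+ (cube k) w (w ∘ flipOutside m) ⟨
  ∑[ x ∈ cube k ] (w x + w (flipOutside m x))          ≤⟨ ∑-mono-≤ (cube k) pair-bound ⟩
  ∑[ x ∈ cube k ] keepsSign± (sumIn m x) (sumOut m x)  ≡⟨ ∑-cube-split m keepsSign± ⟩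
  Σ² (∣ m ∣) (∣ ∁ m ∣) keepsSign±                       ≡⟨ Σ²-keepsSign± (∣ m ∣) (∣ ∁ m ∣) ⟩
  2 * Σ² (∣ m ∣) (∣ ∁ m ∣) keepsSign                    ∎)
  where
  open ≤-Reasoning
  w : Vec Bool k → ℕ
  w x = δ (MAJ k x) (h x)
  a = ∑ (cube k) w
  pair-bound : ∀ x → w x + w (flipOutside m x) ≤ keepsSign± (sumIn m x) (sumOut m x)
  pair-bound x = begin
    δ (sign (sumℤ x)) (h x) + δ (sign (sumℤ (flipOutside m x))) (h (flipOutside m x))
      ≡⟨ cong₂ (λ u v → δ (sign u) (h x) + v) (sumℤ≡sumIn+sumOut m x)
               (cong₂ (λ u b → δ (sign u) b) (sumℤ-flipOutside m x) (h∘flip≗h x)) ⟩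
    δ (sign (s ℤ.+ t)) (h x) + δ (sign (s ℤ.- t)) (h x)
      ≤⟨ δ-pair _ _ (sign s) (h x) (sign-mean s (s ℤ.+ t) (s ℤ.- t) (mean s t)) ⟩
    keepsSign± s t ∎
    where
    s = sumIn m x
    t = sumOut m x
    mean : ∀ s t → (s ℤ.+ t) ℤ.+ (s ℤ.- t) ≡ s ℤ.+ s
    mean = ℤ-Solver.solve-∀

image : ∀ {r k} → (Fin r → Fin k) → Subset k
image {zero}  f = ⊥
image {suc r} f = ⁅ f zero ⁆ ∪ image (λ j → f (suc j))

∈-image : ∀ {r k} (f : Fin r → Fin k) j → f j ∈ image f
∈-image f zero    = x∈p∪q⁺ (inj₁ (x∈⁅x⁆ (f zero)))
∈-image f (suc j) = x∈p∪q⁺ (inj₂ (∈-image (λ j → f (suc j)) j))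

image-∈ : ∀ {r k} (f : Fin r → Fin k) {i} → i ∈ image f → ∃[ j ] f j ≡ i
image-∈ {zero}  f i∈⊥ = ⊥-elim (∉⊥ i∈⊥)
image-∈ {suc r} f i∈ with x∈p∪q⁻ ⁅ f zero ⁆ _ i∈
... | inj₁ i∈⁅f0⁆ = zero , sym (x∈⁅y⁆⇒x≡y (f zero) i∈⁅f0⁆)
... | inj₂ i∈rest = let j , fj≡i = image-∈ (λ j → f (suc j)) i∈rest in suc j , fj≡i

∣⁅x⁆∪p∣≡1+∣p∣ : ∀ {n} (x : Fin n) (p : Subset n) → x ∉ p → ∣ ⁅ x ⁆ ∪ p ∣ ≡ suc ∣ p ∣
∣⁅x⁆∪p∣≡1+∣p∣ zero    (inside  ∷ p) x∉p = ⊥-elim (x∉p here)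
∣⁅x⁆∪p∣≡1+∣p∣ zero    (outside ∷ p) _   = cong (suc ∘ ∣_∣) (∪-identityˡ p)
∣⁅x⁆∪p∣≡1+∣p∣ (suc x) (inside  ∷ p) x∉p = cong suc (∣⁅x⁆∪p∣≡1+∣p∣ x p (x∉p ∘ there))
∣⁅x⁆∪p∣≡1+∣p∣ (suc x) (outside ∷ p) x∉p = ∣⁅x⁆∪p∣≡1+∣p∣ x p (x∉p ∘ there)

∣image∣ : ∀ {r k} (f : Fin r → Fin k) → Injective _≡_ _≡_ f → ∣ image f ∣ ≡ r
∣image∣ {zero}  {k} f _   = ∣⊥∣≡0 k
∣image∣ {suc r}     f inj = trans (∣⁅x⁆∪p∣≡1+∣p∣ (f zero) _ f0∉rest)
                                  (cong suc (∣image∣ (λ j → f (suc j)) (Fin.suc-injective ∘ inj)))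
  where
  f0∉rest : f zero ∉ image (λ j → f (suc j))
  f0∉rest f0∈rest = let j , fj≡f0 = image-∈ (λ j → f (suc j)) f0∈rest in Fin.0≢1+n (inj (sym fj≡f0))

lookup-flipOutside : ∀ {k} {m : Subset k} {i} (x : Vec Bool k) → i ∈ m → lookup (flipOutside m x) i ≡ lookup x i
lookup-flipOutside {m = inside  ∷ m} (b ∷ x) here        = refl
lookup-flipOutside {m = inside  ∷ m} (b ∷ x) (there i∈m) = lookup-flipOutside x i∈m
lookup-flipOutside {m = outside ∷ m} (b ∷ x) (there i∈m) = lookup-flipOutside x i∈m

junta-flipOutside-image : ∀ {r k} (f : Fin r → Fin k) (h : Vec Bool k → Bool) (h′ : Vec Bool r → Bool) →
                          (∀ x → h x ≡ h′ (tabulate (λ j → lookup x (f j)))) →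
                          ∀ x → h (flipOutside (image f) x) ≡ h x
junta-flipOutside-image f h h′ h≗h′∘f x =
  trans (h≗h′∘f _) (trans (cong h′ (tabulate-cong (λ j → lookup-flipOutside x (∈-image f j)))) (sym (h≗h′∘f x)))

junta-agreement : ∀ r (h : Vec Bool (2 * r) → Bool) → IsJunta r h →
                  4 * agree (2 * r) h ≤ 3 * 2 ^ (2 * r) + 2 * central r
junta-agreement r h (f , inj , h′ , h≗h′∘f) = begin
  4 * agree (2 * r) h                      ≤⟨ *-monoʳ-≤ 4 agree≤Σ²r ⟩
  4 * Σ² r r keepsSign                     ≤⟨ keepsSign-count r ⟩
  3 * 2 ^ (r + r) + 2 * balanced (r + r)   ≡⟨ cong₂ (λ n b → 3 * 2 ^ n + 2 * b) r+r≡2r (balanced≡central r) ⟩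
  3 * 2 ^ (2 * r) + 2 * central r          ∎
  where
  open ≤-Reasoning
  m = image f
  r+r≡2r : r + r ≡ 2 * r
  r+r≡2r = cong (r +_) (sym (+-identityʳ r))
  ∣∁m∣≡r : ∣ ∁ m ∣ ≡ r
  ∣∁m∣≡r = begin-equality
    ∣ ∁ m ∣           ≡⟨ ∣∁p∣≡n∸∣p∣ m ⟩
    2 * r ∸ ∣ m ∣     ≡⟨ cong₂ _∸_ r+r≡2r (sym (∣image∣ f inj)) ⟨
    r + r ∸ r         ≡⟨ m+n∸m≡n r r ⟩
    r                 ∎
  agree≤Σ²r : agree (2 * r) h ≤ Σ² r r keepsSign
  agree≤Σ²r = subst₂ (λ a b → agree (2 * r) h ≤ Σ² a b keepsSign) (∣image∣ f inj) ∣∁m∣≡r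
                     (agree≤Σ²keepsSign m h (junta-flipOutside-image f h h′ h≗h′∘f))

excess²-bound : ∀ r a → a ≤ 3 * 2 ^ (2 * r) + 2 * central r →
                (a ∸ 3 * 2 ^ (2 * r)) ^ 2 * (2 * r) ≤ 4 * 4 ^ (2 * r)
excess²-bound r a a≤bound = begin
  (a ∸ 3 * 2 ^ (2 * r)) ^ 2 * (2 * r)
    ≤⟨ *-monoˡ-≤ (2 * r) (^-monoˡ-≤ 2 (m≤n+o⇒m∸n≤o a (3 * 2 ^ (2 * r)) a≤bound)) ⟩
  (2 * c) ^ 2 * (2 * r)                 ≡⟨ regroup c r ⟩
  4 * (c * c * (r + r))                 ≤⟨ *-monoʳ-≤ 4 (*-monoʳ-≤ (c * c) (n≤1+n (r + r))) ⟩
  4 * (c * c * suc (r + r))             ≤⟨ *-monoʳ-≤ 4 (central-bound r) ⟩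
  4 * 16 ^ r                            ≡⟨ cong (4 *_) (^-*-assoc 4 2 r) ⟩
  4 * 4 ^ (2 * r)                       ∎
  where
  open ≤-Reasoning
  c = central r
  regroup : ∀ c r → (2 * c) * ((2 * c) * 1) * (2 * r) ≡ 4 * (c * c * (r + r))
  regroup = ℕ-Solver.solve-∀

claim3 : ∃[ C ] ((m : ℕ) → (h : Vec Bool (2 * suc m) → Bool) → IsJunta (suc m) h →
           ((4 * agree (2 * suc m) h) ∸ (3 * 2 ^ (2 * suc m))) ^ 2 * (2 * suc m)
             ≤ C * 4 ^ (2 * suc m))
claim3 = 4 , λ m h h-junta → excess²-bound (suc m) _ (junta-agreement (suc m) h h-junta)
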